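{- Let $G$ be a finite abelian group, and let $r>q\geq 0$ and $m\geq |G|$ be integers with $\exp(G)\mid m$. Then $$R(S(r,q,m),G)\geq (r-q)m+\max(q,D(G)-1).$$
   Context: $\exp(G)$ is the exponent of $G$. $D(G)$ (the Davenport constant) is the smallest positive integer $d$ such that every sequence of $d$ elements of $G$ has a nonempty subsequence with sum $0$. A collection of $m$ distinct $r$-sets $e_1,\dots,e_m$ is a delta-system of type $S(r,q,m)$ ($0\le q<r$) if there is a set $Q$ with $|Q|=q$ such that $e_i\cap e_j=Q$ for all $i<j$. $K_d^{(r)}$ is the complete $r$-uniform hypergraph on $d$ vertices. $R(S(r,q,m),G)$ is the smallest positive integer $d$ such that for every map $c$ from the edge set of $K_d^{(r)}$ to $G$ there is a delta-system $e_1,\dots,e_m$ of type $S(r,q,m)$ consisting of edges of $K_d^{(r)}$ with $\sum_{i=1}^m c(e_i)=0$. -}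

module Defs where

open import Level using (Level; _⊔_)
open import Algebra.Bundles using (AbelianGroup)
open import Data.Nat using (ℕ; zero; suc; _<_; _≤_)
open import Data.Fin using (Fin; zero; suc)
open import Data.Fin.Subset using (Subset; _∩_; ∣_∣; Nonempty; _∈_)
open import Data.Bool using (true; false)
open import Data.Vec using (lookup)
open import Data.Product using (Σ; ∃; _×_; _,_)
open import Relation.Binary.PropositionalEquality using (_≡_; _≢_)
open import Relation.Nullary using (¬_)

module _ {c ℓ : Level} (G : AbelianGroup c ℓ) where
  open AbelianGroup G

  -- |G| = n : an enumeration Fin n → Carrier, bijective up to the setoid equality
  HasOrder : ℕ → Set (c ⊔ ℓ)
  HasOrder n = Σ (Fin n → Carrier) λ f →
    (∀ x → ∃ λ i → f i ≈ x) × (∀ i j → f i ≈ f j → i ≡ j)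

  _·_ : ℕ → Carrier → Carrier
  zero  · g = ε
  suc k · g = g ∙ (k · g)

  Σ[_] : ∀ {k} → (Fin k → Carrier) → Carrier
  Σ[_] {zero}  f = ε
  Σ[_] {suc k} f = f zero ∙ Σ[ (λ i → f (suc i)) ]

  subSum : ∀ {k} → (Fin k → Carrier) → Subset k → Carrier
  subSum s S = Σ[ (λ i → sel (lookup S i) (s i)) ]
    where
    sel : _ → Carrier → Carrier
    sel true  g = g
    sel false g = ε

  IsExponent : ℕ → Set (c ⊔ ℓ)
  IsExponent e = 0 < e × (∀ g → (e · g) ≈ ε)
               × (∀ e′ → 0 < e′ → e′ < e → ¬ (∀ g → (e′ · g) ≈ ε))

  ZeroSumProp : ℕ → Set (c ⊔ ℓ)
  ZeroSumProp d = (s : Fin d → Carrier) → ∃ λ (S : Subset d) → Nonempty S × subSum s S ≈ ε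

  IsDavenport : ℕ → Set (c ⊔ ℓ)
  IsDavenport D = 0 < D × ZeroSumProp D × (∀ d → 0 < d → d < D → ¬ ZeroSumProp d)

-- e : Fin m → Subset d is a delta-system of type S(r,q,m) (edges of K_d^(r))
IsDeltaSystem : ∀ {d} (r q m : ℕ) → (Fin m → Subset d) → Set
IsDeltaSystem {d} r q m e =
  (∀ i → ∣ e i ∣ ≡ r) × (∀ i j → i ≢ j → e i ≢ e j)
  × (∃ λ (Q : Subset d) → ∣ Q ∣ ≡ q × (∀ i j → i ≢ j → (e i ∩ e j) ≡ Q))

module _ {c ℓ : Level} (G : AbelianGroup c ℓ) where
  open AbelianGroup G

  -- every colouring of the edges (r-subsets) of K_d^(r) by G has a
  -- zero-sum delta-system of type S(r,q,m).  Colourings are given as maps on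
  -- all subsets; only values on r-subsets matter.
  RamseyProp : (r q m d : ℕ) → Set (c ⊔ ℓ)
  RamseyProp r q m d = (col : Subset d → Carrier) →
    ∃ λ (e : Fin m → Subset d) → IsDeltaSystem r q m e × Σ[_] G (λ i → col (e i)) ≈ ε

  -- R(S(r,q,m),G) ≥ N  (R is the least positive d with RamseyProp)
  RamseyAtLeast : (r q m N : ℕ) → Set (c ⊔ ℓ)
  RamseyAtLeast r q m N = ∀ d → 0 < d → d < N → ¬ RamseyProp r q m d

-- If d < (r − q)m + q there is no delta-system of type S(r,q,m) on d vertices at all:
-- its petals e_i ∖ Q are pairwise disjoint, avoid the kernel Q (|Q| = q) and have at least
-- r − q vertices each.
-- Otherwise let s be a sequence of length D(G) − 1, put s_v on vertex v (ε on the remaining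
-- vertices) and colour each edge by the total weight of its vertices.  In a delta-system every
-- edge meets the kernel in the same set, which is therefore counted m times and contributes
-- nothing since exp(G) ∣ m; every other vertex lies in at most one petal.  So a zero-sum
-- delta-system makes the weight of its petal union zero, and as that union has
-- (r − q)m > d − (D(G) − 1) vertices it meets the support of s: s has a nonempty zero-sum
-- subsequence, contradicting the minimality of D(G).

module Submission where

open import Level using (Level)
open import Algebra.Bundles using (AbelianGroup; CommutativeMonoid)
open import Data.Bool using (Bool; true; false; _∧_; _∨_; not; if_then_else_)
open import Data.Bool.Properties using (∧-zeroʳ; ∧-identityʳ)
open import Data.Fin using (Fin; zero; suc; _≟_)
open import Data.Fin.Properties using (suc-injective; nonZeroIndex)
open import Data.Fin.Subset using (Subset; ⊥; _∩_; _∪_; _─_; ⋃; ∣_∣; Nonempty)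
open import Data.Fin.Subset.Properties
  using (∩-assoc; ∩-idem; ∩-comm; ∩-zeroʳ; ∩-distribˡ-∪; ∪-idem; ∣p∣≤n; ∣p∩q∣≤∣q∣; ∣⊥∣≡0; nonempty?; Empty-unique)
import Data.List as List
open import Data.Nat using (ℕ; zero; suc; _+_; _*_; _∸_; _⊔_; _≤_; _<_; z≤n; s≤s; z<s; >-nonZero; >-nonZero⁻¹)
open import Data.Nat.Divisibility using (_∣_; divides)
open import Data.Nat.Properties
  using (+-0-commutativeMonoid; +-comm; *-comm; ⊔-sel; ≤-trans; <⇒≱; n<1+n; n>0⇒n≢0; +-mono-≤; +-monoˡ-≤;
         *-mono-≤; +-cancelʳ-<; m≤n+o⇒m∸n≤o; m<n+o⇒m∸n<o; m<n⇒0<n∸m; module ≤-Reasoning)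
open import Data.Product using (_,_; proj₁; proj₂)
open import Data.Sum using (inj₁; inj₂)
open import Data.Vec using ([]; _∷_; lookup)
open import Data.Vec.Properties using (lookup-zipWith; lookup-replicate)
open import Relation.Binary.PropositionalEquality as ≡
  using (_≡_; _≢_; refl; cong; cong₂; subst; module ≡-Reasoning)
open import Relation.Nullary using (¬_; yes; no; contradiction)
import Relation.Binary.Reasoning.Setoid as ≈-Reasoning

open import Defs

lookup-─ : ∀ {n} (p q : Subset n) v → lookup (p ─ q) v ≡ lookup p v ∧ not (lookup q v)
lookup-─ (x ∷ p) (true  ∷ q) zero    = ≡.sym (∧-zeroʳ x)
lookup-─ (x ∷ p) (false ∷ q) zero    = ≡.sym (∧-identityʳ x)
lookup-─ (x ∷ p) (y     ∷ q) (suc v) = lookup-─ p q v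

─-distribʳ-∩ : ∀ {n} (p q r : Subset n) → (p ─ r) ∩ (q ─ r) ≡ (p ∩ q) ─ r
─-distribʳ-∩ []      []      []          = refl
─-distribʳ-∩ (x ∷ p) (y ∷ q) (true  ∷ r) = cong (false ∷_) (─-distribʳ-∩ p q r)
─-distribʳ-∩ (x ∷ p) (y ∷ q) (false ∷ r) = cong (x ∧ y ∷_) (─-distribʳ-∩ p q r)

p─p≡⊥ : ∀ {n} (p : Subset n) → p ─ p ≡ ⊥
p─p≡⊥ []          = refl
p─p≡⊥ (true  ∷ p) = cong (false ∷_) (p─p≡⊥ p)
p─p≡⊥ (false ∷ p) = cong (false ∷_) (p─p≡⊥ p)

p∩[q─p]≡⊥ : ∀ {n} (p q : Subset n) → p ∩ (q ─ p) ≡ ⊥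
p∩[q─p]≡⊥ []          []      = refl
p∩[q─p]≡⊥ (true  ∷ p) (y ∷ q) = cong (false ∷_) (p∩[q─p]≡⊥ p q)
p∩[q─p]≡⊥ (false ∷ p) (y ∷ q) = cong (false ∷_) (p∩[q─p]≡⊥ p q)

∩-⋃-disjoint : ∀ {n m} (p : Subset n) (f : Fin m → Subset n) →
               (∀ i → p ∩ f i ≡ ⊥) → p ∩ ⋃ (List.tabulate f) ≡ ⊥
∩-⋃-disjoint {m = zero}  p f _ = ∩-zeroʳ p
∩-⋃-disjoint {m = suc m} p f p∩f≡⊥ = begin
  p ∩ (f zero ∪ ⋃ (List.tabulate (λ i → f (suc i))))
    ≡⟨ ∩-distribˡ-∪ p (f zero) _ ⟩
  (p ∩ f zero) ∪ (p ∩ ⋃ (List.tabulate (λ i → f (suc i))))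
    ≡⟨ cong₂ _∪_ (p∩f≡⊥ zero) (∩-⋃-disjoint p (λ i → f (suc i)) (λ i → p∩f≡⊥ (suc i))) ⟩
  ⊥ ∪ ⊥
    ≡⟨ ∪-idem ⊥ ⟩
  ⊥ ∎
  where open ≡-Reasoning

PairwiseDisjoint : ∀ {n m} → (Fin m → Subset n) → Set
PairwiseDisjoint f = ∀ i j → i ≢ j → f i ∩ f j ≡ ⊥

module _ {n m} {f : Fin (suc m) → Subset n} (disjoint : PairwiseDisjoint f) where

  pairwiseDisjoint-tail : PairwiseDisjoint (λ i → f (suc i))
  pairwiseDisjoint-tail i j i≢j = disjoint (suc i) (suc j) (λ eq → i≢j (suc-injective eq))

  pairwiseDisjoint-head : f zero ∩ ⋃ (List.tabulate (λ i → f (suc i))) ≡ ⊥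
  pairwiseDisjoint-head = ∩-⋃-disjoint (f zero) (λ i → f (suc i)) (λ i → disjoint zero (suc i) (λ ()))

∣p∣>0⇒Nonempty : ∀ {n} (p : Subset n) → 0 < ∣ p ∣ → Nonempty p
∣p∣>0⇒Nonempty {n} p 0<∣p∣ with nonempty? p
... | yes p≢∅ = p≢∅
... | no  p≡∅ = contradiction (≡.trans (cong ∣_∣ (Empty-unique p≡∅)) (∣⊥∣≡0 n)) (n>0⇒n≢0 0<∣p∣)

shrink : ∀ {a} b → Subset a → Subset b
shrink zero    _       = []
shrink (suc b) []      = ⊥
shrink (suc b) (x ∷ p) = x ∷ shrink b p

∣p∣≤∣shrink∣+∸ : ∀ {a} b (p : Subset a) → ∣ p ∣ ≤ ∣ shrink b p ∣ + (a ∸ b)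
∣p∣≤∣shrink∣+∸ zero    p           = ∣p∣≤n p
∣p∣≤∣shrink∣+∸ (suc b) []          = z≤n
∣p∣≤∣shrink∣+∸ (suc b) (true  ∷ p) = s≤s (∣p∣≤∣shrink∣+∸ b p)
∣p∣≤∣shrink∣+∸ (suc b) (false ∷ p) = ∣p∣≤∣shrink∣+∸ b p

module SubsetSum {c ℓ : Level} (M : CommutativeMonoid c ℓ) where

  open CommutativeMonoid M renaming (refl to ≈-refl)
  open import Algebra.Definitions.RawMonoid rawMonoid using (_×_)
  open import Algebra.Properties.CommutativeMonoid.Sum M
    using (sum; sum-cong-≋; sum-replicate; sum-replicate-zero; ∑-distrib-+)

  select : Bool → Carrier → Carrier
  select b x = if b then x else ε

  sumOver : ∀ {n} → Subset n → (Fin n → Carrier) → Carrier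
  sumOver p w = sum (λ v → select (lookup p v) (w v))

  select-∨ : ∀ x y a → x ∧ y ≡ false → select (x ∨ y) a ≈ select x a ∙ select y a
  select-∨ true  false a _ = sym (identityʳ a)
  select-∨ false true  a _ = sym (identityˡ a)
  select-∨ false false a _ = sym (identityˡ ε)

  select-split : ∀ x y a → select x a ≈ select (x ∧ y) a ∙ select (x ∧ not y) a
  select-split true  true  a = sym (identityʳ a)
  select-split true  false a = sym (identityˡ a)
  select-split false y     a = sym (identityˡ ε)

  select-ε : ∀ x → select x ε ≈ ε
  select-ε true  = ≈-refl
  select-ε false = ≈-refl

  sumOver-⊥ : ∀ {n} (w : Fin n → Carrier) → sumOver ⊥ w ≈ ε
  sumOver-⊥ {n} w = trans
    (sum-cong-≋ (λ v → reflexive (cong (λ b → select b (w v)) (lookup-replicate v false))))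
    (sum-replicate-zero n)

  sumOver-∪ : ∀ {n} (p q : Subset n) (w : Fin n → Carrier) → p ∩ q ≡ ⊥ →
              sumOver (p ∪ q) w ≈ sumOver p w ∙ sumOver q w
  sumOver-∪ {n} p q w p∩q≡⊥ = trans (sum-cong-≋ {n} pointwise) (∑-distrib-+ {n} _ _)
    where
    disjointAt : ∀ v → lookup p v ∧ lookup q v ≡ false
    disjointAt v = ≡.trans (≡.sym (lookup-zipWith _∧_ v p q))
                           (≡.trans (cong (λ s → lookup s v) p∩q≡⊥) (lookup-replicate v false))
    pointwise : ∀ v → select (lookup (p ∪ q) v) (w v) ≈ select (lookup p v) (w v) ∙ select (lookup q v) (w v)
    pointwise v rewrite lookup-zipWith _∨_ v p q = select-∨ _ _ (w v) (disjointAt v)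

  sumOver-split : ∀ {n} (p q : Subset n) (w : Fin n → Carrier) →
                  sumOver p w ≈ sumOver (p ∩ q) w ∙ sumOver (p ─ q) w
  sumOver-split {n} p q w = trans (sum-cong-≋ {n} pointwise) (∑-distrib-+ {n} _ _)
    where
    pointwise : ∀ v → select (lookup p v) (w v) ≈ select (lookup (p ∩ q) v) (w v) ∙ select (lookup (p ─ q) v) (w v)
    pointwise v rewrite lookup-zipWith _∧_ v p q | lookup-─ p q v = select-split _ _ (w v)

  sumOver-⋃ : ∀ {n m} (f : Fin m → Subset n) (w : Fin n → Carrier) → PairwiseDisjoint f →
              sumOver (⋃ (List.tabulate f)) w ≈ sum (λ i → sumOver (f i) w)
  sumOver-⋃ {m = zero}  f w _        = sumOver-⊥ w
  sumOver-⋃ {m = suc m} f w disjoint = trans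
    (sumOver-∪ (f zero) _ w (pairwiseDisjoint-head disjoint))
    (∙-congˡ (sumOver-⋃ (λ i → f (suc i)) w (pairwiseDisjoint-tail disjoint)))

  -- Truncates s when a < b; shrink b restricts vertex sets accordingly.
  pad : ∀ a {b} → (Fin b → Carrier) → Fin a → Carrier
  pad (suc a) {zero}  s v       = ε
  pad (suc a) {suc b} s zero    = s zero
  pad (suc a) {suc b} s (suc v) = pad a (λ j → s (suc j)) v

  sumOver-pad : ∀ {a} b (s : Fin b → Carrier) (p : Subset a) → sumOver p (pad a s) ≈ sumOver (shrink b p) s
  sumOver-pad zero    s []      = ≈-refl
  sumOver-pad (suc b) s []      = sym (sumOver-⊥ s)
  sumOver-pad {suc a} zero s (x ∷ p) =
    trans (sum-cong-≋ (λ v → select-ε (lookup (x ∷ p) v))) (sum-replicate-zero (suc a))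
  sumOver-pad (suc b) s (x ∷ p) = ∙-congˡ (sumOver-pad b (λ j → s (suc j)) p)

  sum-constant-≈ε : ∀ {m} (f : Fin m → Carrier) → (∀ i j → f i ≈ f j) → (∀ x → m × x ≈ ε) → sum f ≈ ε
  sum-constant-≈ε {zero}  f _        _   = ≈-refl
  sum-constant-≈ε {suc m} f constant ann =
    trans (sum-cong-≋ (λ i → constant i zero)) (trans (sum-replicate (suc m)) (ann (f zero)))

module ℕSum = SubsetSum +-0-commutativeMonoid

∣p∣≡sumOver : ∀ {n} (p : Subset n) → ∣ p ∣ ≡ ℕSum.sumOver p (λ _ → 1)
∣p∣≡sumOver []          = refl
∣p∣≡sumOver (true  ∷ p) = cong suc (∣p∣≡sumOver p)
∣p∣≡sumOver (false ∷ p) = ∣p∣≡sumOver p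

∣p∪q∣≡∣p∣+∣q∣ : ∀ {n} (p q : Subset n) → p ∩ q ≡ ⊥ → ∣ p ∪ q ∣ ≡ ∣ p ∣ + ∣ q ∣
∣p∪q∣≡∣p∣+∣q∣ p q p∩q≡⊥ = begin
  ∣ p ∪ q ∣                                                ≡⟨ ∣p∣≡sumOver (p ∪ q) ⟩
  ℕSum.sumOver (p ∪ q) (λ _ → 1)                           ≡⟨ ℕSum.sumOver-∪ p q _ p∩q≡⊥ ⟩
  ℕSum.sumOver p (λ _ → 1) + ℕSum.sumOver q (λ _ → 1)      ≡⟨ cong₂ _+_ (∣p∣≡sumOver p) (∣p∣≡sumOver q) ⟨
  ∣ p ∣ + ∣ q ∣                                            ∎
  where open ≡-Reasoning

∣p∣≡∣p∩q∣+∣p─q∣ : ∀ {n} (p q : Subset n) → ∣ p ∣ ≡ ∣ p ∩ q ∣ + ∣ p ─ q ∣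
∣p∣≡∣p∩q∣+∣p─q∣ p q = begin
  ∣ p ∣                                                              ≡⟨ ∣p∣≡sumOver p ⟩
  ℕSum.sumOver p (λ _ → 1)                                           ≡⟨ ℕSum.sumOver-split p q _ ⟩
  ℕSum.sumOver (p ∩ q) (λ _ → 1) + ℕSum.sumOver (p ─ q) (λ _ → 1)    ≡⟨ cong₂ _+_ (∣p∣≡sumOver (p ∩ q)) (∣p∣≡sumOver (p ─ q)) ⟨
  ∣ p ∩ q ∣ + ∣ p ─ q ∣                                              ∎
  where open ≡-Reasoning

m*k≤∣⋃∣ : ∀ {n m} k (f : Fin m → Subset n) → PairwiseDisjoint f →
          (∀ i → k ≤ ∣ f i ∣) → m * k ≤ ∣ ⋃ (List.tabulate f) ∣
m*k≤∣⋃∣ {m = zero}  k f _        _     = z≤n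
m*k≤∣⋃∣ {m = suc m} k f disjoint large =
  subst (suc m * k ≤_) (≡.sym (∣p∪q∣≡∣p∣+∣q∣ (f zero) _ (pairwiseDisjoint-head disjoint)))
        (+-mono-≤ (large zero) (m*k≤∣⋃∣ k (λ i → f (suc i)) (pairwiseDisjoint-tail disjoint) (λ i → large (suc i))))

module DeltaSystem {d r q m : ℕ} {e : Fin m → Subset d} (δ : IsDeltaSystem r q m e) where

  kernel : Subset d
  kernel = proj₁ (proj₂ (proj₂ δ))

  petal : Fin m → Subset d
  petal i = e i ─ kernel

  petals : Subset d
  petals = ⋃ (List.tabulate petal)

  private
    ∣e∣≡r : ∀ i → ∣ e i ∣ ≡ r
    ∣e∣≡r = proj₁ δ

    ∣kernel∣≡q : ∣ kernel ∣ ≡ q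
    ∣kernel∣≡q = proj₁ (proj₂ (proj₂ (proj₂ δ)))

    e∩e≡kernel : ∀ {i j} → i ≢ j → e i ∩ e j ≡ kernel
    e∩e≡kernel {i} {j} = proj₂ (proj₂ (proj₂ (proj₂ δ))) i j

  e∩kernel≡kernel : ∀ {i j} → i ≢ j → e i ∩ kernel ≡ kernel
  e∩kernel≡kernel {i} {j} i≢j = begin
    e i ∩ kernel          ≡⟨ cong (e i ∩_) (e∩e≡kernel i≢j) ⟨
    e i ∩ (e i ∩ e j)     ≡⟨ ∩-assoc (e i) (e i) (e j) ⟨
    (e i ∩ e i) ∩ e j     ≡⟨ cong (_∩ e j) (∩-idem (e i)) ⟩
    e i ∩ e j             ≡⟨ e∩e≡kernel i≢j ⟩
    kernel                ∎
    where open ≡-Reasoning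

  -- Not e i ∩ kernel ≡ kernel: for m ≤ 1 the kernel is unconstrained.
  e∩kernel-constant : ∀ i j → e i ∩ kernel ≡ e j ∩ kernel
  e∩kernel-constant i j with i ≟ j
  ... | yes refl = refl
  ... | no  i≢j  = ≡.trans (e∩kernel≡kernel i≢j) (≡.sym (e∩kernel≡kernel (λ j≡i → i≢j (≡.sym j≡i))))

  petals-disjoint : PairwiseDisjoint petal
  petals-disjoint i j i≢j = begin
    (e i ─ kernel) ∩ (e j ─ kernel)   ≡⟨ ─-distribʳ-∩ (e i) (e j) kernel ⟩
    (e i ∩ e j) ─ kernel              ≡⟨ cong (_─ kernel) (e∩e≡kernel i≢j) ⟩
    kernel ─ kernel                   ≡⟨ p─p≡⊥ kernel ⟩
    ⊥                                 ∎
    where open ≡-Reasoning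

  r∸q≤∣petal∣ : ∀ i → r ∸ q ≤ ∣ petal i ∣
  r∸q≤∣petal∣ i = m≤n+o⇒m∸n≤o r q (begin
    r                                  ≡⟨ ∣e∣≡r i ⟨
    ∣ e i ∣                            ≡⟨ ∣p∣≡∣p∩q∣+∣p─q∣ (e i) kernel ⟩
    ∣ e i ∩ kernel ∣ + ∣ petal i ∣     ≤⟨ +-monoˡ-≤ ∣ petal i ∣ (∣p∩q∣≤∣q∣ (e i) kernel) ⟩
    ∣ kernel ∣ + ∣ petal i ∣           ≡⟨ cong (_+ ∣ petal i ∣) ∣kernel∣≡q ⟩
    q + ∣ petal i ∣                    ∎)
    where open ≤-Reasoning

  [r∸q]*m≤∣petals∣ : (r ∸ q) * m ≤ ∣ petals ∣
  [r∸q]*m≤∣petals∣ = subst (_≤ ∣ petals ∣) (*-comm m (r ∸ q)) (m*k≤∣⋃∣ (r ∸ q) petal petals-disjoint r∸q≤∣petal∣)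

  [r∸q]*m+q≤d : (r ∸ q) * m + q ≤ d
  [r∸q]*m+q≤d = begin
    (r ∸ q) * m + q              ≤⟨ +-monoˡ-≤ q [r∸q]*m≤∣petals∣ ⟩
    ∣ petals ∣ + q               ≡⟨ cong (∣ petals ∣ +_) ∣kernel∣≡q ⟨
    ∣ petals ∣ + ∣ kernel ∣      ≡⟨ ∣p∪q∣≡∣p∣+∣q∣ petals kernel petals∩kernel≡⊥ ⟨
    ∣ petals ∪ kernel ∣          ≤⟨ ∣p∣≤n (petals ∪ kernel) ⟩
    d                            ∎
    where
    open ≤-Reasoning
    petals∩kernel≡⊥ : petals ∩ kernel ≡ ⊥
    petals∩kernel≡⊥ = ≡.trans (∩-comm petals kernel) (∩-⋃-disjoint kernel petal (λ i → p∩[q─p]≡⊥ kernel (e i)))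

module _ {c ℓ : Level} (M : CommutativeMonoid c ℓ) where

  open CommutativeMonoid M
  open SubsetSum M
  open import Algebra.Definitions.RawMonoid rawMonoid using (_×_)
  open import Algebra.Properties.CommutativeMonoid.Sum M using (sum; sum-cong-≋; ∑-distrib-+)

  sumOver-edges≈sumOver-petals : ∀ {d r q m} {e : Fin m → Subset d} (δ : IsDeltaSystem r q m e) →
                                 (∀ x → m × x ≈ ε) → (w : Fin d → Carrier) →
                                 sum (λ i → sumOver (e i) w) ≈ sumOver (DeltaSystem.petals δ) w
  sumOver-edges≈sumOver-petals {m = m} {e} δ m×x≈ε w = begin
    sum (λ i → sumOver (e i) w)
      ≈⟨ sum-cong-≋ {m} (λ i → sumOver-split (e i) kernel w) ⟩
    sum (λ i → sumOver (e i ∩ kernel) w ∙ sumOver (petal i) w)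
      ≈⟨ ∑-distrib-+ {m} _ _ ⟩
    sum (λ i → sumOver (e i ∩ kernel) w) ∙ sum (λ i → sumOver (petal i) w)
      ≈⟨ ∙-cong kernelSum≈ε (sym (sumOver-⋃ petal w petals-disjoint)) ⟩
    ε ∙ sumOver petals w
      ≈⟨ identityˡ _ ⟩
    sumOver petals w ∎
    where
    open ≈-Reasoning setoid
    open DeltaSystem δ
    kernelSum≈ε : sum (λ i → sumOver (e i ∩ kernel) w) ≈ ε
    kernelSum≈ε = sum-constant-≈ε _ (λ i j → reflexive (cong (λ p → sumOver p w) (e∩kernel-constant i j))) m×x≈ε

module _ {c ℓ : Level} (G : AbelianGroup c ℓ) where

  open AbelianGroup G hiding (refl)
  open SubsetSum commutativeMonoid
  open import Algebra.Definitions.RawMonoid rawMonoid using (_×_)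
  open import Algebra.Properties.Monoid.Mult monoid using (×-assocˡ; ×-congʳ)
  open import Algebra.Properties.CommutativeMonoid.Sum commutativeMonoid
    using (sum; sum-cong-≋; sum-cong-≗; sum-replicate; sum-replicate-zero)

  Σ≡sum : ∀ {k} (f : Fin k → Carrier) → Σ[ G ] f ≡ sum f
  Σ≡sum {zero}  f = refl
  Σ≡sum {suc k} f = cong (f zero ∙_) (Σ≡sum (λ i → f (suc i)))

  subSum≡sumOver : ∀ {k} (w : Fin k → Carrier) (p : Subset k) → subSum G w p ≡ sumOver p w
  subSum≡sumOver w []          = refl
  subSum≡sumOver w (true  ∷ p) = cong (w zero ∙_) (subSum≡sumOver (λ i → w (suc i)) p)
  subSum≡sumOver w (false ∷ p) = cong (ε ∙_) (subSum≡sumOver (λ i → w (suc i)) p)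

  ·≡× : ∀ k x → _·_ G k x ≡ k × x
  ·≡× zero    x = refl
  ·≡× (suc k) x = cong (x ∙_) (·≡× k x)

  exponent∣m⇒m×x≈ε : ∀ {e m} → IsExponent G e → e ∣ m → ∀ x → m × x ≈ ε
  exponent∣m⇒m×x≈ε {e} (_ , e·x≈ε , _) (divides k refl) x = begin
    (k * e) × x    ≈⟨ ×-assocˡ x k e ⟨
    k × (e × x)    ≈⟨ ×-congʳ k (trans (reflexive (≡.sym (·≡× e x))) (e·x≈ε x)) ⟩
    k × ε          ≈⟨ sum-replicate k ⟨
    sum {k} (λ _ → ε) ≈⟨ sum-replicate-zero k ⟩
    ε              ∎
    where open ≈-Reasoning setoid

  ¬ZeroSumProp[D∸1] : ∀ {D} → IsDavenport G D → ¬ ZeroSumProp G (D ∸ 1)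
  ¬ZeroSumProp[D∸1] {zero}        (() , _)
  ¬ZeroSumProp[D∸1] {suc zero}    _                zs with zs (λ ())
  ... | _ , (() , _) , _
  ¬ZeroSumProp[D∸1] {suc (suc D)} (_ , _ , minimal) = minimal (suc D) z<s (n<1+n (suc D))

  order-positive : ∀ {n} → HasOrder G n → 0 < n
  order-positive (_ , onto , _) = >-nonZero⁻¹ _ {{nonZeroIndex (proj₁ (onto ε))}}

  ramsey⇒zeroSum : ∀ {r q m d B} → 0 < (r ∸ q) * m → (∀ x → m × x ≈ ε) →
                   d < (r ∸ q) * m + B → RamseyProp G r q m d → ZeroSumProp G B
  ramsey⇒zeroSum {r} {q} {m} {d} {B} 0<X m×x≈ε d<X+B ramsey s
    with ramsey (λ p → subSum G (pad d s) p)
  ... | e , δ , e-sum≈ε = S , ∣p∣>0⇒Nonempty S 0<∣S∣ , S-sum≈ε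
    where
    open DeltaSystem δ using (petals; [r∸q]*m≤∣petals∣)

    w : Fin d → Carrier
    w = pad d s

    S : Subset B
    S = shrink B petals

    0<∣S∣ : 0 < ∣ S ∣
    0<∣S∣ = +-cancelʳ-< (d ∸ B) 0 ∣ S ∣ (begin-strict
      d ∸ B                  <⟨ m<n+o⇒m∸n<o d B {{>-nonZero 0<X}} (subst (d <_) (+-comm _ B) d<X+B) ⟩
      (r ∸ q) * m            ≤⟨ [r∸q]*m≤∣petals∣ ⟩
      ∣ petals ∣             ≤⟨ ∣p∣≤∣shrink∣+∸ B petals ⟩
      ∣ S ∣ + (d ∸ B)        ∎)
      where open ≤-Reasoning

    S-sum≈ε : subSum G s S ≈ ε
    S-sum≈ε = begin
      subSum G s S                      ≡⟨ subSum≡sumOver s S ⟩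
      sumOver S s                       ≈⟨ sumOver-pad B s petals ⟨
      sumOver petals w                  ≈⟨ sumOver-edges≈sumOver-petals commutativeMonoid δ m×x≈ε w ⟨
      sum (λ i → sumOver (e i) w)       ≡⟨ ≡.trans (Σ≡sum (λ i → subSum G w (e i))) (sum-cong-≗ {m} (λ i → subSum≡sumOver w (e i))) ⟨
      Σ[ G ] (λ i → subSum G w (e i))   ≈⟨ e-sum≈ε ⟩
      ε                                 ∎
      where open ≈-Reasoning setoid

lemma2p6 : ∀ {c ℓ : Level} (G : AbelianGroup c ℓ) (n : ℕ) → HasOrder G n →
    (e D : ℕ) → IsExponent G e → IsDavenport G D →
    (r q m : ℕ) → q < r → n ≤ m → e ∣ m →
    RamseyAtLeast G r q m ((r ∸ q) * m + (q ⊔ (D ∸ 1)))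
lemma2p6 G n order e D exponent davenport r q m q<r n≤m e∣m d _ d<N ramsey with ⊔-sel q (D ∸ 1)
... | inj₁ q⊔≡q   = <⇒≱ (subst (λ t → d < (r ∸ q) * m + t) q⊔≡q d<N) (DeltaSystem.[r∸q]*m+q≤d δ)
  where δ = proj₁ (proj₂ (ramsey (λ _ → AbelianGroup.ε G)))
... | inj₂ q⊔≡D∸1 = ¬ZeroSumProp[D∸1] G davenport
  (ramsey⇒zeroSum G 0<X (exponent∣m⇒m×x≈ε G exponent e∣m) (subst (λ t → d < (r ∸ q) * m + t) q⊔≡D∸1 d<N) ramsey)
  where
  0<X : 0 < (r ∸ q) * m
  0<X = *-mono-≤ {1} {r ∸ q} {1} {m} (m<n⇒0<n∸m q<r) (≤-trans (order-positive G order) n≤m)
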